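{- Let $d\ge1$ and $f_d(0,d-1,x)=\sum_{k=0}^{d-1}C_{d-1-k}\binom{d-1-k}{k}(x-1)^k$, where $C_n=\frac1{n+1}\binom{2n}{n}$. Then for every $k$, the coefficient of $x^k$ in $f_d(0,d-1,x)$ equals the number of plane trees on $d$ vertices with exactly $k$ type $(0)$ special vertices.
   Context: A plane tree is a rooted tree whose children at each vertex are linearly ordered left to right; a vertex $v$ is a type $(0)$ special vertex if $v$ is a leaf, $v$ is the leftmost child of its parent, and the parent of $v$ is not the root. ($f_d(0,d-1,x)$ is the contribution of a shelling component of type $(0,d-1)$ to the toric $f$-polynomial of a shellable $(d-1)$-dimensional cubical complex.) -}

module Defs where

open import Data.Nat using (ℕ; zero; suc; _+_; _*_; _∸_)
open import Data.Nat.DivMod using (_/_)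
open import Data.Nat.Combinatorics using (_C_)
open import Data.Integer as ℤ using (ℤ; +_)
open import Data.List using (List; []; _∷_)

-- Univariate polynomials with integer coefficients, as coefficient lists
-- (lowest degree first).  Missing coefficients are 0.

Poly : Set
Poly = List ℤ

_⊕_ : Poly → Poly → Poly
[] ⊕ q = q
(a ∷ p) ⊕ [] = a ∷ p
(a ∷ p) ⊕ (b ∷ q) = (a ℤ.+ b) ∷ (p ⊕ q)

scale : ℤ → Poly → Poly
scale c [] = []
scale c (a ∷ p) = (c ℤ.* a) ∷ scale c p

_⊗_ : Poly → Poly → Poly
[] ⊗ q = []
(a ∷ p) ⊗ q = scale a q ⊕ (+ 0 ∷ (p ⊗ q))

one : Poly
one = + 1 ∷ []

_^^_ : Poly → ℕ → Poly
p ^^ zero = one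
p ^^ suc n = p ⊗ (p ^^ n)

const : ℤ → Poly
const c = c ∷ []

xMinus1 : Poly
xMinus1 = ℤ.-[1+ 0 ] ∷ + 1 ∷ []

coeff : ℕ → Poly → ℤ
coeff k [] = + 0
coeff zero (a ∷ p) = a
coeff (suc k) (a ∷ p) = coeff k p

polySum : ℕ → (ℕ → Poly) → Poly
polySum zero f = []
polySum (suc n) f = polySum n f ⊕ f n

catalan : ℕ → ℕ
catalan n = ((2 * n) C n) / suc n

fd : ℕ → Poly
fd d = polySum d (λ k →
  const (+ (catalan (d ∸ 1 ∸ k) * ((d ∸ 1 ∸ k) C k))) ⊗ (xMinus1 ^^ k))

data PlaneTree : Set where
  node : List PlaneTree → PlaneTree

mutual
  size : PlaneTree → ℕ
  size (node cs) = suc (sizeF cs)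

  sizeF : List PlaneTree → ℕ
  sizeF [] = 0
  sizeF (t ∷ ts) = size t + sizeF ts

isLeaf : PlaneTree → ℕ
isLeaf (node []) = 1
isLeaf (node (_ ∷ _)) = 0

mutual
  -- number of type (0) special vertices strictly below a NON-ROOT vertex t
  -- (a vertex v is type (0) special iff v is a leaf, v is the leftmost
  --  child of its parent, and the parent of v is not the root)
  below : PlaneTree → ℕ
  below (node []) = 0
  below (node (c ∷ cs)) = isLeaf c + below c + belowF cs

  belowF : List PlaneTree → ℕ
  belowF [] = 0
  belowF (t ∷ ts) = below t + belowF ts

-- number of type (0) special vertices of a plane tree (whose root is its root);
-- the root's children are never special since their parent is the root.
special0 : PlaneTree → ℕ
special0 (node cs) = belowF cs

module Submission where

-- Since x^s = Σ_j binom(s, j) (x - 1)^j, it suffices to show that the coefficient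
-- C_{n-j} binom(n-j, j) is the binomial moment Σ_t binom(special0 t, j) over all trees t
-- on n + 1 vertices (moment-trees) and then to invert (moment-inversion).  The moments
-- are computed on forests: `forests a r` enumerates the forests of r trees with a
-- non-root vertices by grafting the second tree onto the first.  Along this recursion,
-- marking j special vertices is counted by forestCount (a - j) r * binom(a - j + r, j)
-- (moment-forests), where forestCount is a ballot number, equal to the Catalan number
-- for a single tree (forestCount≡catalan).

open import Defs
open import Data.Nat using (ℕ; zero; suc; _+_; _*_; _∸_; _≤_; _<_; _≥_; z≤n; s≤s; _≟_; _≤?_)
open import Data.Nat.Properties
open import Data.Nat.Combinatorics using (_C_; nCk≡nC[n∸k]; nCk+nC[k+1]≡[n+1]C[k+1]; nC1≡n)
open import Data.Nat.DivMod using (_/_; m*n/n≡m)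
open import Data.Nat.Tactic.RingSolver using (solve-∀)
open import Data.Integer as ℤ using (ℤ; +_; -_)
import Data.Integer.Properties as ℤₚ
import Data.Integer.Tactic.RingSolver as ℤ-Solver
open import Data.Bool using (if_then_else_; true; false)
open import Data.List using (List; []; _∷_; filter; _++_; _∷ʳ_; map; length; initLast; _∷ʳ′_)
open import Data.List.Properties using (∷-injective; ∷-injectiveʳ; ∷ʳ-injective; length-map; length-++; map-++; map-∘; map-cong-local)
open import Data.Nat.ListAction using (sum)
open import Data.Nat.ListAction.Properties using (sum-++)
open import Data.List.Membership.Propositional using (_∈_)
open import Data.List.Membership.Propositional.Properties using (∈-filter⁺; ∈-filter⁻; ∈-map⁺; ∈-map⁻; ∈-++⁺ˡ; ∈-++⁺ʳ; ∈-++⁻)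
open import Data.List.Relation.Unary.Any using (here; there)
import Data.List.Relation.Unary.All as All
import Data.List.Relation.Unary.All.Properties as All
open import Data.List.Relation.Unary.AllPairs using ([]; _∷_)
open import Data.List.Relation.Unary.Unique.Propositional using (Unique)
import Data.List.Relation.Unary.Unique.Propositional.Properties as Unique
open import Data.Product using (Σ; _×_; _,_; proj₁; proj₂)
open import Data.Sum using (inj₁; inj₂; [_,_]′)
open import Data.Empty using (⊥-elim)
open import Relation.Nullary using (¬_; yes; no; does)
open import Function using (_∘_)
open import Function.Bundles using (_⇔_; mk⇔)
open import Relation.Binary.PropositionalEquality

map-unique : ∀ {A B : Set} (f : A → B) {xs : List A} →
  (∀ {x y} → x ∈ xs → y ∈ xs → f x ≡ f y → x ≡ y) → Unique xs → Unique (map f xs)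
map-unique f inj []            = []
map-unique f inj (x∉xs ∷ uniq) =
  All.map⁺ (All.tabulate λ y∈xs fx≡fy → All.lookup x∉xs y∈xs (inj (here refl) (there y∈xs) fx≡fy))
  ∷ map-unique f (λ x∈ y∈ → inj (there x∈) (there y∈)) uniq

∈-map-elim : ∀ {A B : Set} {f : A → B} {xs : List A} (P : B → Set) →
             (∀ x → x ∈ xs → P (f x)) → ∀ {y} → y ∈ map f xs → P y
∈-map-elim {f = f} P pf y∈ with ∈-map⁻ f y∈
... | x , x∈ , refl = pf x x∈

sumOver : ∀ {A : Set} → List A → (A → ℕ) → ℕ
sumOver xs g = sum (map g xs)

module _ {A : Set} where

  sumOver-++ : ∀ (xs ys : List A) g → sumOver (xs ++ ys) g ≡ sumOver xs g + sumOver ys g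
  sumOver-++ xs ys g = trans (cong sum (map-++ g xs ys)) (sum-++ (map g xs) (map g ys))

  sumOver-map : ∀ {B : Set} (h : B → A) xs g → sumOver (map h xs) g ≡ sumOver xs (g ∘ h)
  sumOver-map h xs g = cong sum (sym (map-∘ xs))

  sumOver-cong : ∀ (xs : List A) {g g′} → (∀ x → x ∈ xs → g x ≡ g′ x) → sumOver xs g ≡ sumOver xs g′
  sumOver-cong xs eq = cong sum (map-cong-local (All.tabulate λ {x} x∈ → eq x x∈))

  sumOver-+ : ∀ (xs : List A) g h → sumOver xs (λ x → g x + h x) ≡ sumOver xs g + sumOver xs h
  sumOver-+ []       g h = refl
  sumOver-+ (x ∷ xs) g h = begin
    g x + h x + sumOver xs (λ x → g x + h x)    ≡⟨ cong (_+_ (g x + h x)) (sumOver-+ xs g h) ⟩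
    g x + h x + (sumOver xs g + sumOver xs h)   ≡⟨ interchange (g x) (h x) (sumOver xs g) (sumOver xs h) ⟩
    g x + sumOver xs g + (h x + sumOver xs h)   ∎
    where
    open ≡-Reasoning
    interchange : ∀ a b c d → a + b + (c + d) ≡ a + c + (b + d)
    interchange = solve-∀

  sumOver-zero : ∀ (xs : List A) g → (∀ x → x ∈ xs → g x ≡ 0) → sumOver xs g ≡ 0
  sumOver-zero []       g null = refl
  sumOver-zero (x ∷ xs) g null = cong₂ _+_ (null x (here refl)) (sumOver-zero xs g (λ y y∈ → null y (there y∈)))

  sumOver-length : ∀ (xs : List A) → sumOver xs (λ _ → 1) ≡ length xs
  sumOver-length []       = refl
  sumOver-length (x ∷ xs) = cong suc (sumOver-length xs)

-- Binomial coefficients as Pascal's triangle; agrees with the library's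
-- `_C_` but unfolds definitionally along Pascal's rule.
binom : ℕ → ℕ → ℕ
binom n       zero    = 1
binom zero    (suc k) = 0
binom (suc n) (suc k) = binom n k + binom n (suc k)

binom-vanish : ∀ n k → n < k → binom n k ≡ 0
binom-vanish zero    (suc k) _         = refl
binom-vanish (suc n) (suc k) (s≤s n<k) =
  cong₂ _+_ (binom-vanish n k n<k) (binom-vanish n (suc k) (m≤n⇒m≤1+n n<k))

binom≡C : ∀ n k → binom n k ≡ n C k
binom≡C n       zero    = refl
binom≡C zero    (suc k) = refl
binom≡C (suc n) (suc k) =
  trans (cong₂ _+_ (binom≡C n k) (binom≡C n (suc k))) (nCk+nC[k+1]≡[n+1]C[k+1] n k)

binom-sym : ∀ a b → binom (a + b) a ≡ binom (a + b) b
binom-sym a b = begin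
  binom (a + b) a          ≡⟨ binom≡C (a + b) a ⟩
  (a + b) C a              ≡⟨ nCk≡nC[n∸k] (m≤m+n a b) ⟩
  (a + b) C (a + b ∸ a)    ≡⟨ cong ((a + b) C_) (m+n∸m≡n a b) ⟩
  (a + b) C b              ≡⟨ binom≡C (a + b) b ⟨
  binom (a + b) b          ∎
  where open ≡-Reasoning

binom-absorb : ∀ n k → suc k * binom (suc n) (suc k) ≡ suc n * binom n k
binom-absorb n       zero    =
  trans (+-identityʳ _) (cong suc (trans (binom≡C n 1) (trans (nC1≡n n) (sym (*-identityʳ n)))))
binom-absorb zero    (suc k) = *-zeroʳ (suc (suc k))
binom-absorb (suc n) (suc k) = begin
  suc (suc k) * (p + q)               ≡⟨ split k p q ⟩
  suc k * p + p + suc (suc k) * q     ≡⟨ cong₂ (λ u v → u + p + v) (binom-absorb n k) (binom-absorb n (suc k)) ⟩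
  suc n * binom n k + p + suc n * binom n (suc k)
                                      ≡⟨ merge n (binom n k) (binom n (suc k)) ⟩
  suc (suc n) * p                     ∎
  where
  open ≡-Reasoning
  p = binom (suc n) (suc k)
  q = binom (suc n) (suc (suc k))
  split : ∀ k p q → suc (suc k) * (p + q) ≡ suc k * p + p + suc (suc k) * q
  split = solve-∀
  merge : ∀ n x y → suc n * x + (x + y) + suc n * y ≡ suc (suc n) * (x + y)
  merge = solve-∀

binomPred : ℕ → ℕ → ℕ
binomPred X zero    = 0
binomPred X (suc a) = binom X a

pascal : ∀ X a → binom (suc X) a ≡ binomPred X a + binom X a
pascal X zero    = refl
pascal X (suc a) = refl

binom-bump : ∀ b w j → b ≤ 1 → binom (b + w) (suc j) ≡ binom w (suc j) + b * binom w j
binom-bump zero          w j _        = sym (+-identityʳ (binom w (suc j)))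
binom-bump (suc zero)    w j _        =
  trans (+-comm (binom w j) (binom w (suc j))) (cong (_+_ (binom w (suc j))) (sym (+-identityʳ (binom w j))))
binom-bump (suc (suc b)) w j (s≤s ())

leaf : PlaneTree
leaf = node []

sizeF-++ : ∀ xs ys → sizeF (xs ++ ys) ≡ sizeF xs + sizeF ys
sizeF-++ []       ys = refl
sizeF-++ (x ∷ xs) ys = trans (cong (_+_ (size x)) (sizeF-++ xs ys)) (sym (+-assoc (size x) (sizeF xs) (sizeF ys)))

sizeF-∷ʳ : ∀ cs c → sizeF (cs ∷ʳ c) ≡ sizeF cs + size c
sizeF-∷ʳ cs c = trans (sizeF-++ cs (c ∷ [])) (cong (_+_ (sizeF cs)) (+-identityʳ (size c)))

belowF-++ : ∀ xs ys → belowF (xs ++ ys) ≡ belowF xs + belowF ys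
belowF-++ []       ys = refl
belowF-++ (x ∷ xs) ys = trans (cong (_+_ (below x)) (belowF-++ xs ys)) (sym (+-assoc (below x) (belowF xs) (belowF ys)))

-- Special vertices are non-root vertices, and in a forest no root is special:
-- below t < size t, and belowF f + (number of roots) ≤ sizeF f.
mutual
  below<size : ∀ t → below t < size t
  below<size (node [])       = s≤s z≤n
  below<size (node (c ∷ cs)) = s≤s (+-mono-≤ (firstChild c) (belowF≤sizeF cs))
    where
    firstChild : ∀ c → isLeaf c + below c ≤ size c
    firstChild (node [])       = s≤s z≤n
    firstChild (node (x ∷ xs)) = <⇒≤ (below<size (node (x ∷ xs)))

  belowF+length≤sizeF : ∀ f → belowF f + length f ≤ sizeF f
  belowF+length≤sizeF []       = z≤n
  belowF+length≤sizeF (t ∷ ts) = begin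
    below t + belowF ts + suc (length ts)    ≡⟨ regroup (below t) (belowF ts) (length ts) ⟩
    suc (below t) + (belowF ts + length ts)  ≤⟨ +-mono-≤ (below<size t) (belowF+length≤sizeF ts) ⟩
    size t + sizeF ts                        ∎
    where
    open ≤-Reasoning
    regroup : ∀ a b c → a + b + suc c ≡ suc a + (b + c)
    regroup = solve-∀

  belowF≤sizeF : ∀ f → belowF f ≤ sizeF f
  belowF≤sizeF f = ≤-trans (m≤m+n (belowF f) (length f)) (belowF+length≤sizeF f)

length≤sizeF : ∀ f → length f ≤ sizeF f
length≤sizeF f = ≤-trans (m≤n+m (length f) (belowF f)) (belowF+length≤sizeF f)

graft : List PlaneTree → List PlaneTree
graft (node cs ∷ c ∷ ts) = node (cs ∷ʳ c) ∷ ts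
graft f                  = f

-- `forests a r` lists the forests of r plane trees with a non-root vertices
-- (a + r vertices in all): either the first tree is a single leaf, or it arises
-- by grafting from a forest with one more tree and one fewer non-root vertex.
forests : ℕ → ℕ → List (List PlaneTree)
forests zero    zero    = [] ∷ []
forests (suc a) zero    = []
forests zero    (suc r) = map (leaf ∷_) (forests zero r)
forests (suc a) (suc r) = map (leaf ∷_) (forests (suc a) r) ++ map graft (forests a (suc (suc r)))

Shape : ℕ → ℕ → List PlaneTree → Set
Shape a r f = length f ≡ r × sizeF f ≡ a + r

leaf-shape : ∀ a r f → Shape a r f → Shape a (suc r) (leaf ∷ f)
leaf-shape a r f (len , sz) = cong suc len , trans (cong suc sz) (sym (+-suc a r))

leaf-shape⁻ : ∀ a r f → Shape a (suc r) (leaf ∷ f) → Shape a r f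
leaf-shape⁻ a r f (len , sz) = suc-injective len , suc-injective (trans sz (+-suc a r))

graft-shape : ∀ a r cs c ts → Shape a (suc (suc r)) (node cs ∷ c ∷ ts) →
              Shape (suc a) (suc r) (node (cs ∷ʳ c) ∷ ts)
graft-shape a r cs c ts (len , sz) = suc-injective len , (begin
  suc (sizeF (cs ∷ʳ c)) + sizeF ts      ≡⟨ cong (λ x → suc x + sizeF ts) (sizeF-∷ʳ cs c) ⟩
  suc (sizeF cs + size c + sizeF ts)    ≡⟨ cong suc (+-assoc (sizeF cs) (size c) (sizeF ts)) ⟩
  suc (sizeF cs) + (size c + sizeF ts)  ≡⟨ sz ⟩
  a + suc (suc r)                       ≡⟨ +-suc a (suc r) ⟩
  suc a + suc r                         ∎)
  where open ≡-Reasoning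

graft-shape⁻ : ∀ a r cs c ts → Shape (suc a) (suc r) (node (cs ∷ʳ c) ∷ ts) →
               Shape a (suc (suc r)) (node cs ∷ c ∷ ts)
graft-shape⁻ a r cs c ts (len , sz) = cong suc len , (begin
  suc (sizeF cs) + (size c + sizeF ts)  ≡⟨ cong suc (+-assoc (sizeF cs) (size c) (sizeF ts)) ⟨
  suc (sizeF cs + size c + sizeF ts)    ≡⟨ cong (λ x → suc x + sizeF ts) (sizeF-∷ʳ cs c) ⟨
  suc (sizeF (cs ∷ʳ c)) + sizeF ts      ≡⟨ sz ⟩
  suc a + suc r                         ≡⟨ +-suc a (suc r) ⟨
  a + suc (suc r)                       ∎)
  where open ≡-Reasoning

-- A grafted forest has at least one non-root vertex, so it never has shape (0, r).
graft-nonroot : ∀ r cs c ts → ¬ Shape zero (suc r) (node (cs ∷ʳ c) ∷ ts)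
graft-nonroot r cs c ts (len , sz) = 1+n≰n (begin
  suc (suc r)                           ≡⟨ cong suc len ⟨
  suc (suc (length ts))                 ≤⟨ +-mono-≤ (root+child c) (length≤sizeF ts) ⟩
  size (node (cs ∷ʳ c)) + sizeF ts      ≡⟨ sz ⟩
  suc r                                 ∎)
  where
  open ≤-Reasoning
  root+child : ∀ c → 2 ≤ size (node (cs ∷ʳ c))
  root+child (node ds) = s≤s (≤-trans (s≤s z≤n)
    (≤-trans (m≤n+m (size (node ds)) (sizeF cs)) (≤-reflexive (sym (sizeF-∷ʳ cs (node ds))))))

forests-sound : ∀ a r f → f ∈ forests a r → Shape a r f
forests-sound zero    zero    .[] (here refl) = refl , refl
forests-sound zero    zero    f   (there ())
forests-sound zero    (suc r) f   f∈ =
  ∈-map-elim (Shape zero (suc r)) (λ g g∈ → leaf-shape zero r g (forests-sound zero r g g∈)) f∈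
forests-sound (suc a) (suc r) f   f∈ =
  [ ∈-map-elim (Shape (suc a) (suc r)) (λ g g∈ → leaf-shape (suc a) r g (forests-sound (suc a) r g g∈))
  , ∈-map-elim (Shape (suc a) (suc r)) (λ g g∈ → shape-graft g (forests-sound a (suc (suc r)) g g∈))
  ]′ (∈-++⁻ (map (leaf ∷_) (forests (suc a) r)) f∈)
  where
  shape-graft : ∀ g → Shape a (suc (suc r)) g → Shape (suc a) (suc r) (graft g)
  shape-graft (node cs ∷ c ∷ ts) sh = graft-shape a r cs c ts sh

forests-complete : ∀ a r f → Shape a r f → f ∈ forests a r
forests-complete zero    zero    []      _       = here refl
forests-complete (suc a) zero    []      (_ , ())
forests-complete a       zero    (_ ∷ _) (() , _)
forests-complete a       (suc r) []      (() , _)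
forests-complete a (suc r) (node cs ∷ ts) sh with initLast cs
forests-complete zero    (suc r) (node .[] ∷ ts) sh | [] =
  ∈-map⁺ (leaf ∷_) (forests-complete zero r ts (leaf-shape⁻ zero r ts sh))
forests-complete (suc a) (suc r) (node .[] ∷ ts) sh | [] =
  ∈-++⁺ˡ (∈-map⁺ (leaf ∷_) (forests-complete (suc a) r ts (leaf-shape⁻ (suc a) r ts sh)))
forests-complete zero    (suc r) (node .(cs ∷ʳ c) ∷ ts) sh | cs ∷ʳ′ c =
  ⊥-elim (graft-nonroot r cs c ts sh)
forests-complete (suc a) (suc r) (node .(cs ∷ʳ c) ∷ ts) sh | cs ∷ʳ′ c =
  ∈-++⁺ʳ (map (leaf ∷_) (forests (suc a) r))
    (∈-map⁺ graft (forests-complete a (suc (suc r)) (node cs ∷ c ∷ ts) (graft-shape⁻ a r cs c ts sh)))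

node-injective : ∀ {xs ys} → node xs ≡ node ys → xs ≡ ys
node-injective refl = refl

graft-injective : ∀ {r g g'} → length g ≡ suc (suc r) → length g' ≡ suc (suc r) →
                  graft g ≡ graft g' → g ≡ g'
graft-injective {g = node cs ∷ c ∷ ts} {node cs' ∷ c' ∷ ts'} _ _ eq
  with refl , refl ← ∷ʳ-injective cs cs' (node-injective (proj₁ (∷-injective eq)))
  = cong (λ ts → node cs ∷ c ∷ ts) (proj₂ (∷-injective eq))

graft-no-leaf : ∀ {r} g {ts} → length g ≡ suc (suc r) → graft g ≢ leaf ∷ ts
graft-no-leaf (node []       ∷ c ∷ _) _ ()
graft-no-leaf (node (_ ∷ _)  ∷ c ∷ _) _ ()

forests-unique : ∀ a r → Unique (forests a r)
forests-unique zero    zero    = All.[] ∷ []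
forests-unique (suc a) zero    = []
forests-unique zero    (suc r) = Unique.map⁺ ∷-injectiveʳ (forests-unique zero r)
forests-unique (suc a) (suc r) = Unique.++⁺
  (Unique.map⁺ ∷-injectiveʳ (forests-unique (suc a) r))
  (map-unique graft (λ g∈ g'∈ → graft-injective (len g∈) (len g'∈)) (forests-unique a (suc (suc r))))
  disjoint
  where
  len : ∀ {g} → g ∈ forests a (suc (suc r)) → length g ≡ suc (suc r)
  len {g} g∈ = proj₁ (forests-sound a (suc (suc r)) g g∈)
  disjoint : ∀ {f} → ¬ (f ∈ map (leaf ∷_) (forests (suc a) r) × f ∈ map graft (forests a (suc (suc r))))
  disjoint (f∈leaf , f∈graft) with ∈-map⁻ (leaf ∷_) f∈leaf | ∈-map⁻ graft f∈graft
  ... | _ , _ , refl | g , g∈ , eq = graft-no-leaf g (len g∈) (sym eq)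

-- `forestsFrom A r` lists the forests with A + r vertices and at least r trees,
-- concatenating `forests (A + r - r') r'` over all r' ≥ r.
forestsFrom : ℕ → ℕ → List (List PlaneTree)
forestsFrom zero    r = forests zero r
forestsFrom (suc A) r = forests (suc A) r ++ forestsFrom A (suc r)

forestsFrom-sound : ∀ A r f → f ∈ forestsFrom A r → sizeF f ≡ A + r × r ≤ length f
forestsFrom-sound zero r f f∈ =
  let len , sz = forests-sound zero r f f∈ in sz , ≤-reflexive (sym len)
forestsFrom-sound (suc A) r f f∈ = [ here-r , later ]′ (∈-++⁻ (forests (suc A) r) f∈)
  where
  here-r : f ∈ forests (suc A) r → sizeF f ≡ suc A + r × r ≤ length f
  here-r f∈ = let len , sz = forests-sound (suc A) r f f∈ in sz , ≤-reflexive (sym len)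
  later : f ∈ forestsFrom A (suc r) → sizeF f ≡ suc A + r × r ≤ length f
  later f∈ = let sz , r<len = forestsFrom-sound A (suc r) f f∈ in trans sz (+-suc A r) , <⇒≤ r<len

forestsFrom-complete : ∀ A r f → sizeF f ≡ A + r → r ≤ length f → f ∈ forestsFrom A r
forestsFrom-complete zero r f sz r≤len =
  forests-complete zero r f (≤-antisym (≤-trans (length≤sizeF f) (≤-reflexive sz)) r≤len , sz)
forestsFrom-complete (suc A) r f sz r≤len with length f ≟ r
... | yes len = ∈-++⁺ˡ (forests-complete (suc A) r f (len , sz))
... | no  len≢r = ∈-++⁺ʳ (forests (suc A) r)
  (forestsFrom-complete A (suc r) f (trans sz (sym (+-suc A r))) (≤∧≢⇒< r≤len (len≢r ∘ sym)))

forestsFrom-unique : ∀ A r → Unique (forestsFrom A r)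
forestsFrom-unique zero    r = forests-unique zero r
forestsFrom-unique (suc A) r = Unique.++⁺ (forests-unique (suc A) r) (forestsFrom-unique A (suc r)) disjoint
  where
  -- the first block has exactly r trees, the rest more
  disjoint : ∀ {f} → ¬ (f ∈ forests (suc A) r × f ∈ forestsFrom A (suc r))
  disjoint {f} (f∈ , f∈′) = 1+n≰n (≤-trans (proj₂ (forestsFrom-sound A (suc r) f f∈′))
                                           (≤-reflexive (proj₁ (forests-sound (suc A) r f f∈))))

-- The plane trees with n + 1 vertices: a root above a forest with n vertices.
trees : ℕ → List PlaneTree
trees n = map node (forestsFrom n zero)

trees-sound : ∀ n t → t ∈ trees n → size t ≡ suc n
trees-sound n t = ∈-map-elim (λ t → size t ≡ suc n)
  (λ cs cs∈ → cong suc (trans (proj₁ (forestsFrom-sound n zero cs cs∈)) (+-identityʳ n)))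

trees-complete : ∀ n t → size t ≡ suc n → t ∈ trees n
trees-complete n (node cs) sz =
  ∈-map⁺ node (forestsFrom-complete n zero cs (trans (suc-injective sz) (sym (+-identityʳ n))) z≤n)

trees-unique : ∀ n → Unique (trees n)
trees-unique n = Unique.map⁺ node-injective (forestsFrom-unique n zero)

forestCount : ℕ → ℕ → ℕ
forestCount a r = length (forests a r)

forestCount-zero : ∀ r → forestCount zero r ≡ 1
forestCount-zero zero    = refl
forestCount-zero (suc r) = trans (length-map (leaf ∷_) (forests zero r)) (forestCount-zero r)

forestCount-step : ∀ a r → forestCount (suc a) (suc r) ≡ forestCount (suc a) r + forestCount a (suc (suc r))
forestCount-step a r = trans (length-++ (map (leaf ∷_) (forests (suc a) r)))
  (cong₂ _+_ (length-map (leaf ∷_) (forests (suc a) r)) (length-map graft (forests a (suc (suc r)))))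

-- Ballot numbers: the forests of r + 1 trees with a non-root vertices number
-- binom(2a+r, a) - binom(2a+r, a-1).
Ballot : ℕ → ℕ → ℕ → Set
Ballot a r X = forestCount a (suc r) + binomPred X a ≡ binom X a

ballot : ∀ a r → Ballot a r (a + a + r)
ballot zero    r = cong (_+ 0) (forestCount-zero (suc r))
ballot (suc a) zero = begin
  forestCount (suc a) 1 + binom (suc a + suc a + 0) a
    ≡⟨ cong₂ _+_ (forestCount-step a 0) (cong (λ n → binom n a) (double a)) ⟩
  forestCount a 2 + binom (suc Z) a
    ≡⟨ cong (_+_ (forestCount a 2)) (pascal Z a) ⟩
  forestCount a 2 + (binomPred Z a + binom Z a)
    ≡⟨ +-assoc (forestCount a 2) (binomPred Z a) (binom Z a) ⟨
  forestCount a 2 + binomPred Z a + binom Z a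
    ≡⟨ cong (_+ binom Z a) (subst (Ballot a 1) (oddIndex a) (ballot a 1)) ⟩
  binom Z a + binom Z a
    ≡⟨ cong (_+_ (binom Z a)) (binom-sym (suc a) a) ⟨
  binom (suc Z) (suc a)
    ≡⟨ cong (λ n → binom n (suc a)) (double a) ⟨
  binom (suc a + suc a + 0) (suc a) ∎
  where
  open ≡-Reasoning
  Z = suc a + a
  double : ∀ a → suc a + suc a + 0 ≡ suc (suc a + a)
  double = solve-∀
  oddIndex : ∀ a → a + a + 1 ≡ suc a + a
  oddIndex = solve-∀
ballot (suc a) (suc r) = begin
  forestCount (suc a) (suc (suc r)) + binom (suc a + suc a + suc r) a
    ≡⟨ cong₂ _+_ (forestCount-step a (suc r)) (cong (λ n → binom n a) (grow a r)) ⟩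
  P + Q + binom (suc Y) a
    ≡⟨ cong (_+_ (P + Q)) (pascal Y a) ⟩
  P + Q + (binomPred Y a + binom Y a)
    ≡⟨ regroup P Q (binomPred Y a) (binom Y a) ⟩
  (P + binom Y a) + (Q + binomPred Y a)
    ≡⟨ cong₂ _+_ (subst (Ballot (suc a) r) (shift a r) (ballot (suc a) r)) (ballot a (suc (suc r))) ⟩
  binom Y (suc a) + binom Y a
    ≡⟨ +-comm (binom Y (suc a)) (binom Y a) ⟩
  binom (suc Y) (suc a)
    ≡⟨ cong (λ n → binom n (suc a)) (grow a r) ⟨
  binom (suc a + suc a + suc r) (suc a) ∎
  where
  open ≡-Reasoning
  Y = a + a + suc (suc r)
  P = forestCount (suc a) (suc r)
  Q = forestCount a (suc (suc (suc r)))
  grow : ∀ a r → suc a + suc a + suc r ≡ suc (a + a + suc (suc r))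
  grow = solve-∀
  shift : ∀ a r → suc a + suc a + r ≡ a + a + suc (suc r)
  shift = solve-∀
  regroup : ∀ p q u v → p + q + (u + v) ≡ (p + v) + (q + u)
  regroup = solve-∀

central-shift : ∀ m → m * binom (m + m) m ≡ suc m * binomPred (m + m) m
central-shift zero    = refl
central-shift (suc m) = begin
  suc m * binom (suc n) (suc m)              ≡⟨ binom-absorb n m ⟩
  suc n * binom n m                          ≡⟨ cong (suc n *_) (binom-sym m (suc m)) ⟩
  suc n * binom n (suc m)                    ≡⟨ binom-absorb n (suc m) ⟨
  suc (suc m) * binom (suc n) (suc (suc m))  ≡⟨ cong (λ k → suc (suc m) * binom k (suc (suc m))) (+-suc m (suc m)) ⟨
  suc (suc m) * binom (m + suc (suc m)) (suc (suc m))
                                             ≡⟨ cong (suc (suc m) *_) (binom-sym m (suc (suc m))) ⟨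
  suc (suc m) * binom (m + suc (suc m)) m    ≡⟨ cong (λ k → suc (suc m) * binom k m) (+-suc m (suc m)) ⟩
  suc (suc m) * binom (suc n) m              ∎
  where
  open ≡-Reasoning
  n = m + suc m

forestCount≡catalan : ∀ m → forestCount m 1 ≡ catalan m
forestCount≡catalan m = sym (begin
  ((2 * m) C m) / suc m         ≡⟨ cong (λ k → (k C m) / suc m) (cong (_+_ m) (+-identityʳ m)) ⟩
  ((m + m) C m) / suc m         ≡⟨ cong (_/ suc m) (binom≡C (m + m) m) ⟨
  binom (m + m) m / suc m       ≡⟨ cong (_/ suc m) (trans (sym scaled) (*-comm (suc m) N)) ⟩
  (N * suc m) / suc m           ≡⟨ m*n/n≡m N (suc m) ⟩
  N                             ∎)
  where
  open ≡-Reasoning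
  N = forestCount m 1
  B = binom (m + m) m
  P = binomPred (m + m) m
  total : N + P ≡ B
  total = subst (Ballot m 0) (+-identityʳ (m + m)) (ballot m 0)
  -- (m+1) N + (m+1) P = (m+1) B = B + (m+1) P
  scaled : suc m * N ≡ B
  scaled = +-cancelʳ-≡ (suc m * P) (suc m * N) B (begin
    suc m * N + suc m * P   ≡⟨ *-distribˡ-+ (suc m) N P ⟨
    suc m * (N + P)         ≡⟨ cong (suc m *_) total ⟩
    B + m * B               ≡⟨ cong (_+_ B) (central-shift m) ⟩
    B + suc m * P           ∎)

-- The j-th binomial moment Σ_f binom(belowF f, j) of the special-vertex count of
-- a list of forests (it counts forests with j marked special vertices).
moment : ℕ → List (List PlaneTree) → ℕ
moment j fs = sumOver fs (λ f → binom (belowF f) j)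

-- A leading single leaf is a root, hence never special.
moment-leaf : ∀ j fs → moment j (map (leaf ∷_) fs) ≡ moment j fs
moment-leaf j fs = sumOver-map (leaf ∷_) fs (λ f → binom (belowF f) j)

moment-vanish : ∀ A j fs → (∀ f → f ∈ fs → belowF f ≤ A) → A < j → moment j fs ≡ 0
moment-vanish A j fs bound A<j =
  sumOver-zero fs _ (λ f f∈ → binom-vanish (belowF f) j (≤-<-trans (bound f f∈) A<j))

forests-below : ∀ A r f → f ∈ forests A r → belowF f ≤ A
forests-below A r f f∈ = +-cancelʳ-≤ r (belowF f) A (begin
  belowF f + r            ≡⟨ cong (_+_ (belowF f)) len ⟨
  belowF f + length f     ≤⟨ belowF+length≤sizeF f ⟩
  sizeF f                 ≡⟨ sz ⟩
  A + r                   ∎)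
  where
  open ≤-Reasoning
  len = proj₁ (forests-sound A r f f∈)
  sz  = proj₂ (forests-sound A r f f∈)

forestsFrom-below : ∀ A r f → f ∈ forestsFrom A r → belowF f ≤ A
forestsFrom-below A r f f∈ = +-cancelʳ-≤ r (belowF f) A (begin
  belowF f + r            ≤⟨ +-monoʳ-≤ (belowF f) (proj₂ (forestsFrom-sound A r f f∈)) ⟩
  belowF f + length f     ≤⟨ belowF+length≤sizeF f ⟩
  sizeF f                 ≡⟨ proj₁ (forestsFrom-sound A r f f∈) ⟩
  A + r                   ∎)
  where open ≤-Reasoning

-- Grafting creates a new special vertex exactly when the forest starts with two
-- single leaves: the second leaf becomes the leftmost child of a non-root vertex.
newSpecial : List PlaneTree → ℕ
newSpecial (node [] ∷ node [] ∷ _) = 1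
newSpecial _                       = 0

belowF-graft : ∀ g → belowF (graft g) ≡ newSpecial g + belowF g
belowF-graft []                                = refl
belowF-graft (node []      ∷ [])               = refl
belowF-graft (node (_ ∷ _) ∷ [])               = refl
belowF-graft (node [] ∷ node [] ∷ ts)          = refl
belowF-graft (node [] ∷ node (x ∷ xs) ∷ ts)    = cong (_+ belowF ts) (+-identityʳ (below (node (x ∷ xs))))
belowF-graft (node (d ∷ ds) ∷ c ∷ ts) = begin
  isLeaf d + below d + belowF (ds ∷ʳ c) + belowF ts
    ≡⟨ cong (λ n → isLeaf d + below d + n + belowF ts) (belowF-++ ds (c ∷ [])) ⟩
  isLeaf d + below d + (belowF ds + (below c + 0)) + belowF ts
    ≡⟨ regroup (isLeaf d + below d) (belowF ds) (below c) (belowF ts) ⟩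
  isLeaf d + below d + belowF ds + (below c + belowF ts) ∎
  where
  open ≡-Reasoning
  regroup : ∀ a b c d → a + (b + (c + 0)) + d ≡ a + b + (c + d)
  regroup = solve-∀

newSpecial-graft : ∀ g → newSpecial (graft g) ≡ 0
newSpecial-graft []                      = refl
newSpecial-graft (node []      ∷ [])     = refl
newSpecial-graft (node (_ ∷ _) ∷ [])     = refl
newSpecial-graft (node []      ∷ c ∷ ts) = refl
newSpecial-graft (node (_ ∷ _) ∷ c ∷ ts) = refl

newSpecial-leaf-graft : ∀ {r} g → length g ≡ suc (suc r) → newSpecial (leaf ∷ graft g) ≡ 0
newSpecial-leaf-graft (node []      ∷ c ∷ ts) _ = refl
newSpecial-leaf-graft (node (_ ∷ _) ∷ c ∷ ts) _ = refl

newSpecial≤1 : ∀ g → newSpecial g ≤ 1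
newSpecial≤1 (node [] ∷ node [] ∷ _)      = s≤s z≤n
newSpecial≤1 []                           = z≤n
newSpecial≤1 (node [] ∷ [])               = z≤n
newSpecial≤1 (node [] ∷ node (_ ∷ _) ∷ _) = z≤n
newSpecial≤1 (node (_ ∷ _) ∷ _)           = z≤n

-- The moment of the new special vertices: marked sets that use the new vertex.
newMoment : ℕ → List (List PlaneTree) → ℕ
newMoment j fs = sumOver fs (λ g → newSpecial g * binom (belowF g) j)

moment-graft : ∀ j gs → moment (suc j) (map graft gs) ≡ moment (suc j) gs + newMoment j gs
moment-graft j gs = begin
  moment (suc j) (map graft gs)
    ≡⟨ sumOver-map graft gs (λ f → binom (belowF f) (suc j)) ⟩
  sumOver gs (λ g → binom (belowF (graft g)) (suc j))
    ≡⟨ sumOver-cong gs (λ g _ → trans (cong (λ b → binom b (suc j)) (belowF-graft g))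
                                      (binom-bump (newSpecial g) (belowF g) j (newSpecial≤1 g))) ⟩
  sumOver gs (λ g → binom (belowF g) (suc j) + newSpecial g * binom (belowF g) j)
    ≡⟨ sumOver-+ gs _ _ ⟩
  moment (suc j) gs + newMoment j gs ∎
  where open ≡-Reasoning

newMoment-two-leaves : ∀ j fs → newMoment j (map (leaf ∷_) (map (leaf ∷_) fs)) ≡ moment j fs
newMoment-two-leaves j fs =
  trans (sumOver-map (leaf ∷_) (map (leaf ∷_) fs) _)
    (trans (sumOver-map (leaf ∷_) fs _) (sumOver-cong fs (λ f _ → +-identityʳ (binom (belowF f) j))))

-- Among forests with r + 2 trees, new special vertices arise only from those that
-- start with two leaves, i.e. from the forests with r trees.
newMoment-forests : ∀ A r j → newMoment j (forests A (suc (suc r))) ≡ moment j (forests A r)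
newMoment-forests zero    r j = newMoment-two-leaves j (forests zero r)
newMoment-forests (suc A) r j = begin
  newMoment j (map (leaf ∷_) (map (leaf ∷_) F ++ map graft G₂) ++ map graft G₃)
    ≡⟨ sumOver-++ (map (leaf ∷_) (map (leaf ∷_) F ++ map graft G₂)) (map graft G₃) _ ⟩
  newMoment j (map (leaf ∷_) (map (leaf ∷_) F ++ map graft G₂)) + newMoment j (map graft G₃)
    ≡⟨ cong₂ _+_ (cong (newMoment j) (map-++ (leaf ∷_) (map (leaf ∷_) F) (map graft G₂))) grafts ⟩
  newMoment j (map (leaf ∷_) (map (leaf ∷_) F) ++ map (leaf ∷_) (map graft G₂)) + 0
    ≡⟨ +-identityʳ _ ⟩
  newMoment j (map (leaf ∷_) (map (leaf ∷_) F) ++ map (leaf ∷_) (map graft G₂))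
    ≡⟨ sumOver-++ (map (leaf ∷_) (map (leaf ∷_) F)) (map (leaf ∷_) (map graft G₂)) _ ⟩
  newMoment j (map (leaf ∷_) (map (leaf ∷_) F)) + newMoment j (map (leaf ∷_) (map graft G₂))
    ≡⟨ cong₂ _+_ (newMoment-two-leaves j F) leaf-grafts ⟩
  moment j F + 0
    ≡⟨ +-identityʳ _ ⟩
  moment j F ∎
  where
  open ≡-Reasoning
  F  = forests (suc A) r
  G₂ = forests A (suc (suc r))
  G₃ = forests A (suc (suc (suc r)))
  grafts : newMoment j (map graft G₃) ≡ 0
  grafts = trans (sumOver-map graft G₃ _)
    (sumOver-zero G₃ _ (λ g _ → cong (_* binom (belowF (graft g)) j) (newSpecial-graft g)))
  leaf-grafts : newMoment j (map (leaf ∷_) (map graft G₂)) ≡ 0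
  leaf-grafts = trans (sumOver-map (leaf ∷_) (map graft G₂) _)
    (trans (sumOver-map graft G₂ _)
      (sumOver-zero G₂ _ (λ g g∈ → cong (_* binom (belowF (graft g)) j)
        (newSpecial-leaf-graft g (proj₁ (forests-sound A (suc (suc r)) g g∈))))))

moment-recurrence : ∀ A r j → moment (suc j) (forests (suc A) (suc r))
  ≡ moment (suc j) (forests (suc A) r) + (moment (suc j) (forests A (suc (suc r))) + moment j (forests A r))
moment-recurrence A r j = begin
  moment (suc j) (map (leaf ∷_) F ++ map graft G₂)
    ≡⟨ sumOver-++ (map (leaf ∷_) F) (map graft G₂) _ ⟩
  moment (suc j) (map (leaf ∷_) F) + moment (suc j) (map graft G₂)
    ≡⟨ cong₂ _+_ (moment-leaf (suc j) F) (moment-graft j G₂) ⟩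
  moment (suc j) F + (moment (suc j) G₂ + newMoment j G₂)
    ≡⟨ cong (λ m → moment (suc j) F + (moment (suc j) G₂ + m)) (newMoment-forests A r j) ⟩
  moment (suc j) F + (moment (suc j) G₂ + moment j (forests A r)) ∎
  where
  open ≡-Reasoning
  F  = forests (suc A) r
  G₂ = forests A (suc (suc r))

moment-forests : ∀ A r j a → j + a ≡ A → moment j (forests A r) ≡ forestCount a r * binom (a + r) j
moment-forests A       r       zero    .A refl = trans (sumOver-length (forests A r)) (sym (*-identityʳ _))
moment-forests zero    r       (suc j) a  ()
moment-forests (suc A) zero    (suc j) zero    eq = refl
moment-forests (suc A) zero    (suc j) (suc a) eq = refl
moment-forests (suc A) (suc r) (suc j) a  eq = begin
  moment (suc j) (forests (suc A) (suc r))
    ≡⟨ moment-recurrence A r j ⟩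
  moment (suc j) (forests (suc A) r) + (moment (suc j) G₂ + moment j (forests A r))
    ≡⟨ cong₂ (λ x y → x + (moment (suc j) G₂ + y))
             (moment-forests (suc A) r (suc j) a eq) (moment-forests A r j a (suc-injective eq)) ⟩
  forestCount a r * binom (a + r) (suc j) + (moment (suc j) G₂ + forestCount a r * binom (a + r) j)
    ≡⟨ combine a eq ⟩
  forestCount a (suc r) * binom (a + suc r) (suc j) ∎
  where
  open ≡-Reasoning
  G₂ = forests A (suc (suc r))
  combine : ∀ a → suc j + a ≡ suc A →
    forestCount a r * binom (a + r) (suc j) + (moment (suc j) G₂ + forestCount a r * binom (a + r) j)
      ≡ forestCount a (suc r) * binom (a + suc r) (suc j)
  -- with no spare non-root vertex, G₂ has too few special vertices for suc j marks
  combine zero eq′ = begin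
    N * binom r (suc j) + (moment (suc j) G₂ + N * binom r j)
      ≡⟨ cong (λ m → N * binom r (suc j) + (m + N * binom r j))
              (moment-vanish A (suc j) G₂ (forests-below A (suc (suc r)))
                (s≤s (≤-reflexive (trans (sym (suc-injective eq′)) (+-identityʳ j))))) ⟩
    N * binom r (suc j) + (0 + N * binom r j)
      ≡⟨ factor N (binom r j) (binom r (suc j)) ⟩
    N * binom (suc r) (suc j)
      ≡⟨ cong (_* binom (suc r) (suc j)) (length-map (leaf ∷_) (forests zero r)) ⟨
    forestCount zero (suc r) * binom (suc r) (suc j) ∎
    where
    N = forestCount zero r
    factor : ∀ x p q → x * q + (0 + x * p) ≡ x * (p + q)
    factor = solve-∀
  combine (suc a) eq′ = begin
    P * binom (suc a + r) (suc j) + (moment (suc j) G₂ + P * binom (suc a + r) j)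
      ≡⟨ cong (λ m → P * binom (suc a + r) (suc j) + (m + P * binom (suc a + r) j))
              (moment-forests A (suc (suc r)) (suc j) a (suc-injective (trans (cong suc (sym (+-suc j a))) eq′))) ⟩
    P * binom (suc a + r) (suc j) + (Q * binom (a + suc (suc r)) (suc j) + P * binom (suc a + r) j)
      ≡⟨ cong (λ n → P * binom (suc a + r) (suc j) + (Q * binom n (suc j) + P * binom (suc a + r) j))
              (trans (+-suc a (suc r)) (cong suc (+-suc a r))) ⟩
    P * binom (suc a + r) (suc j) + (Q * binom (suc (suc a + r)) (suc j) + P * binom (suc a + r) j)
      ≡⟨ factor P Q (binom (suc a + r) j) (binom (suc a + r) (suc j)) ⟩
    (P + Q) * binom (suc (suc a + r)) (suc j)
      ≡⟨ cong₂ _*_ (forestCount-step a r) (cong (λ n → binom n (suc j)) (+-suc (suc a) r)) ⟨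
    forestCount (suc a) (suc r) * binom (suc a + suc r) (suc j) ∎
    where
    P = forestCount (suc a) r
    Q = forestCount a (suc (suc r))
    factor : ∀ x y p q → x * q + (y * (p + q) + x * p) ≡ (x + y) * (p + q)
    factor = solve-∀

moment-forestsFrom : ∀ A r j a → j + a ≡ A → moment j (forestsFrom A r) ≡ forestCount a (suc r) * binom (a + r) j
moment-forestsFrom zero r zero zero refl =
  trans (moment-forests zero r zero zero refl) (cong (_* 1) (sym (length-map (leaf ∷_) (forests zero r))))
moment-forestsFrom zero r zero (suc a) ()
moment-forestsFrom zero r (suc j) a ()
moment-forestsFrom (suc A) r j a eq = begin
  moment j (forests (suc A) r ++ forestsFrom A (suc r))
    ≡⟨ sumOver-++ (forests (suc A) r) (forestsFrom A (suc r)) _ ⟩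
  moment j (forests (suc A) r) + moment j (forestsFrom A (suc r))
    ≡⟨ cong (_+ moment j (forestsFrom A (suc r))) (moment-forests (suc A) r j a eq) ⟩
  forestCount a r * binom (a + r) j + moment j (forestsFrom A (suc r))
    ≡⟨ more-trees a eq ⟩
  forestCount a (suc r) * binom (a + r) j ∎
  where
  open ≡-Reasoning
  more-trees : ∀ a → j + a ≡ suc A →
    forestCount a r * binom (a + r) j + moment j (forestsFrom A (suc r)) ≡ forestCount a (suc r) * binom (a + r) j
  -- with a = 0 the remaining forests have too few special vertices for j marks
  more-trees zero eq′ = begin
    forestCount zero r * binom r j + moment j (forestsFrom A (suc r))
      ≡⟨ cong (_+_ (forestCount zero r * binom r j))
              (moment-vanish A j _ (forestsFrom-below A (suc r)) (≤-reflexive (trans (sym eq′) (+-identityʳ j)))) ⟩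
    forestCount zero r * binom r j + 0
      ≡⟨ +-identityʳ _ ⟩
    forestCount zero r * binom r j
      ≡⟨ cong (_* binom r j) (length-map (leaf ∷_) (forests zero r)) ⟨
    forestCount zero (suc r) * binom r j ∎
  more-trees (suc a) eq′ = begin
    P * binom (suc a + r) j + moment j (forestsFrom A (suc r))
      ≡⟨ cong (_+_ (P * binom (suc a + r) j)) (moment-forestsFrom A (suc r) j a (suc-injective (trans (sym (+-suc j a)) eq′))) ⟩
    P * binom (suc a + r) j + Q * binom (a + suc r) j
      ≡⟨ cong (λ n → P * binom (suc a + r) j + Q * binom n j) (+-suc a r) ⟩
    P * binom (suc a + r) j + Q * binom (suc a + r) j
      ≡⟨ *-distribʳ-+ (binom (suc a + r) j) P Q ⟨
    (P + Q) * binom (suc a + r) j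
      ≡⟨ cong (_* binom (suc a + r) j) (forestCount-step a r) ⟨
    forestCount (suc a) (suc r) * binom (suc a + r) j ∎
    where
    P = forestCount (suc a) r
    Q = forestCount a (suc (suc r))

moment-trees : ∀ n j → sumOver (trees n) (λ t → binom (special0 t) j) ≡ catalan (n ∸ j) * ((n ∸ j) C j)
moment-trees n j with j ≤? n
... | yes j≤n = begin
  sumOver (trees n) (λ t → binom (special0 t) j)
    ≡⟨ sumOver-map node (forestsFrom n zero) _ ⟩
  moment j (forestsFrom n zero)
    ≡⟨ moment-forestsFrom n zero j (n ∸ j) (m+[n∸m]≡n j≤n) ⟩
  forestCount (n ∸ j) 1 * binom (n ∸ j + 0) j
    ≡⟨ cong₂ _*_ (forestCount≡catalan (n ∸ j)) (trans (cong (λ m → binom m j) (+-identityʳ (n ∸ j))) (binom≡C (n ∸ j) j)) ⟩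
  catalan (n ∸ j) * ((n ∸ j) C j) ∎
  where open ≡-Reasoning
... | no j≰n = begin
  sumOver (trees n) (λ t → binom (special0 t) j)
    ≡⟨ sumOver-map node (forestsFrom n zero) _ ⟩
  moment j (forestsFrom n zero)
    ≡⟨ moment-vanish n j _ (forestsFrom-below n zero) n<j ⟩
  0
    ≡⟨ binom-vanish 0 j (≤-trans (s≤s z≤n) n<j) ⟨
  binom 0 j
    ≡⟨ *-identityˡ (binom 0 j) ⟨
  catalan 0 * binom 0 j
    ≡⟨ cong (λ m → catalan m * binom m j) (m≤n⇒m∸n≡0 (<⇒≤ n<j)) ⟨
  catalan (n ∸ j) * binom (n ∸ j) j
    ≡⟨ cong (catalan (n ∸ j) *_) (binom≡C (n ∸ j) j) ⟩
  catalan (n ∸ j) * ((n ∸ j) C j) ∎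
  where
  open ≡-Reasoning
  n<j = ≰⇒> j≰n

pos-+-* : ∀ a b c → + (a + b) ℤ.* c ≡ + a ℤ.* c ℤ.+ + b ℤ.* c
pos-+-* a b c = trans (cong (ℤ._* c) (ℤₚ.pos-+ a b)) (ℤₚ.*-distribʳ-+ c (+ a) (+ b))

Σ< : ℕ → (ℕ → ℤ) → ℤ
Σ< zero    g = + 0
Σ< (suc n) g = Σ< n g ℤ.+ g n

Σ<-cong : ∀ n {g h : ℕ → ℤ} → (∀ j → g j ≡ h j) → Σ< n g ≡ Σ< n h
Σ<-cong zero    eq = refl
Σ<-cong (suc n) eq = cong₂ ℤ._+_ (Σ<-cong n eq) (eq n)

Σ<-+ : ∀ n (g h : ℕ → ℤ) → Σ< n (λ j → g j ℤ.+ h j) ≡ Σ< n g ℤ.+ Σ< n h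
Σ<-+ zero    g h = refl
Σ<-+ (suc n) g h = trans (cong (ℤ._+ (g n ℤ.+ h n)) (Σ<-+ n g h)) (interchange (Σ< n g) (Σ< n h) (g n) (h n))
  where
  interchange : ∀ a b c d → a ℤ.+ b ℤ.+ (c ℤ.+ d) ≡ a ℤ.+ c ℤ.+ (b ℤ.+ d)
  interchange = ℤ-Solver.solve-∀

Σ<-neg : ∀ n (g : ℕ → ℤ) → Σ< n (λ j → - g j) ≡ - Σ< n g
Σ<-neg zero    g = refl
Σ<-neg (suc n) g = trans (cong (ℤ._+ - g n) (Σ<-neg n g)) (sym (ℤₚ.neg-distrib-+ (Σ< n g) (g n)))

Σ<-zero : ∀ n → Σ< n (λ _ → + 0) ≡ + 0
Σ<-zero zero    = refl
Σ<-zero (suc n) = trans (ℤₚ.+-identityʳ _) (Σ<-zero n)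

Σ<-first : ∀ n (g : ℕ → ℤ) → Σ< (suc n) g ≡ g 0 ℤ.+ Σ< n (λ j → g (suc j))
Σ<-first zero    g = ℤₚ.+-comm (+ 0) (g 0)
Σ<-first (suc n) g = trans (cong (ℤ._+ g (suc n)) (Σ<-first n g)) (ℤₚ.+-assoc (g 0) _ (g (suc n)))

coeff-⊕ : ∀ k p q → coeff k (p ⊕ q) ≡ coeff k p ℤ.+ coeff k q
coeff-⊕ k       []      q       = sym (ℤₚ.+-identityˡ (coeff k q))
coeff-⊕ k       (a ∷ p) []      = sym (ℤₚ.+-identityʳ (coeff k (a ∷ p)))
coeff-⊕ zero    (a ∷ p) (b ∷ q) = refl
coeff-⊕ (suc k) (a ∷ p) (b ∷ q) = coeff-⊕ k p q

coeff-scale : ∀ k c p → coeff k (scale c p) ≡ c ℤ.* coeff k p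
coeff-scale k       c []      = sym (ℤₚ.*-zeroʳ c)
coeff-scale zero    c (a ∷ p) = refl
coeff-scale (suc k) c (a ∷ p) = coeff-scale k c p

coeff-const⊗ : ∀ k c p → coeff k (const c ⊗ p) ≡ c ℤ.* coeff k p
coeff-const⊗ k c p = trans (coeff-⊕ k (scale c p) (+ 0 ∷ []))
  (trans (cong₂ ℤ._+_ (coeff-scale k c p) (zero-poly k)) (ℤₚ.+-identityʳ _))
  where
  zero-poly : ∀ k → coeff k (+ 0 ∷ []) ≡ + 0
  zero-poly zero    = refl
  zero-poly (suc k) = refl

coeff-polySum : ∀ k n f → coeff k (polySum n f) ≡ Σ< n (λ j → coeff k (f j))
coeff-polySum k zero    f = refl
coeff-polySum k (suc n) f = trans (coeff-⊕ k (polySum n f) (f n)) (cong (ℤ._+ coeff k (f n)) (coeff-polySum k n f))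

coeffX : ℕ → Poly → ℤ
coeffX zero    p = + 0
coeffX (suc k) p = coeff k p

coeff-x-1⊗ : ∀ k p → coeff k (xMinus1 ⊗ p) ≡ coeffX k p ℤ.+ - coeff k p
coeff-x-1⊗ k p = begin
  coeff k (scale ℤ.-1ℤ p ⊕ (+ 0 ∷ (const (+ 1) ⊗ p)))
    ≡⟨ coeff-⊕ k (scale ℤ.-1ℤ p) _ ⟩
  coeff k (scale ℤ.-1ℤ p) ℤ.+ coeff k (+ 0 ∷ (const (+ 1) ⊗ p))
    ≡⟨ cong₂ ℤ._+_ (trans (coeff-scale k ℤ.-1ℤ p) (ℤₚ.-1*i≡-i (coeff k p))) (times-x k) ⟩
  - coeff k p ℤ.+ coeffX k p
    ≡⟨ ℤₚ.+-comm (- coeff k p) (coeffX k p) ⟩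
  coeffX k p ℤ.+ - coeff k p ∎
  where
  open ≡-Reasoning
  times-x : ∀ k → coeff k (+ 0 ∷ (const (+ 1) ⊗ p)) ≡ coeffX k p
  times-x zero    = refl
  times-x (suc k) = trans (coeff-const⊗ k (+ 1) p) (ℤₚ.*-identityˡ (coeff k p))

powCoeff : ℕ → ℕ → ℤ
powCoeff j k = coeff k (xMinus1 ^^ j)

expansion : ℕ → ℕ → ℕ → ℤ
expansion N s k = Σ< N (λ j → + binom s j ℤ.* powCoeff j k)

-- Terms with j > s vanish, so the range N > s does not matter.
expansion-extend : ∀ N s k → s < N → expansion (suc N) s k ≡ expansion N s k
expansion-extend N s k s<N = trans
  (cong (λ b → expansion N s k ℤ.+ + b ℤ.* powCoeff N k) (binom-vanish s N s<N))
  (ℤₚ.+-identityʳ (expansion N s k))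

expansion-pascal : ∀ s k →
  expansion (suc (suc s)) (suc s) k ≡ Σ< (suc s) (λ j → + binom s j ℤ.* powCoeff (suc j) k) ℤ.+ expansion (suc s) s k
expansion-pascal s k = begin
  expansion (suc (suc s)) (suc s) k
    ≡⟨ Σ<-first (suc s) _ ⟩
  + 1 ℤ.* powCoeff 0 k ℤ.+ Σ< (suc s) (λ j → + (binom s j + binom s (suc j)) ℤ.* powCoeff (suc j) k)
    ≡⟨ cong (ℤ._+_ (+ 1 ℤ.* powCoeff 0 k))
            (trans (Σ<-cong (suc s) (λ j → pos-+-* (binom s j) (binom s (suc j)) (powCoeff (suc j) k)))
                   (Σ<-+ (suc s) _ _)) ⟩
  + 1 ℤ.* powCoeff 0 k ℤ.+ (L ℤ.+ R)
    ≡⟨ swap (+ 1 ℤ.* powCoeff 0 k) L R ⟩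
  L ℤ.+ (+ 1 ℤ.* powCoeff 0 k ℤ.+ R)
    ≡⟨ cong (ℤ._+_ L) (trans (sym (Σ<-first (suc s) _)) (expansion-extend (suc s) s k ≤-refl)) ⟩
  L ℤ.+ expansion (suc s) s k ∎
  where
  open ≡-Reasoning
  L = Σ< (suc s) (λ j → + binom s j ℤ.* powCoeff (suc j) k)
  R = Σ< (suc s) (λ j → + binom s (suc j) ℤ.* powCoeff (suc j) k)
  swap : ∀ a b c → a ℤ.+ (b ℤ.+ c) ≡ b ℤ.+ (a ℤ.+ c)
  swap = ℤ-Solver.solve-∀

expansion-shift : ∀ s k → Σ< (suc s) (λ j → + binom s j ℤ.* powCoeff (suc j) k)
  ≡ Σ< (suc s) (λ j → + binom s j ℤ.* coeffX k (xMinus1 ^^ j)) ℤ.+ - expansion (suc s) s k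
expansion-shift s k = begin
  Σ< (suc s) (λ j → + binom s j ℤ.* powCoeff (suc j) k)
    ≡⟨ Σ<-cong (suc s) (λ j → trans (cong (+ binom s j ℤ.*_) (coeff-x-1⊗ k (xMinus1 ^^ j)))
                                    (distrib (+ binom s j) (coeffX k (xMinus1 ^^ j)) (powCoeff j k))) ⟩
  Σ< (suc s) (λ j → + binom s j ℤ.* coeffX k (xMinus1 ^^ j) ℤ.+ - (+ binom s j ℤ.* powCoeff j k))
    ≡⟨ Σ<-+ (suc s) _ _ ⟩
  Σ< (suc s) (λ j → + binom s j ℤ.* coeffX k (xMinus1 ^^ j)) ℤ.+ Σ< (suc s) (λ j → - (+ binom s j ℤ.* powCoeff j k))
    ≡⟨ cong (ℤ._+_ (Σ< (suc s) (λ j → + binom s j ℤ.* coeffX k (xMinus1 ^^ j))))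
            (Σ<-neg (suc s) (λ j → + binom s j ℤ.* powCoeff j k)) ⟩
  Σ< (suc s) (λ j → + binom s j ℤ.* coeffX k (xMinus1 ^^ j)) ℤ.+ - expansion (suc s) s k ∎
  where
  open ≡-Reasoning
  distrib : ∀ c a b → c ℤ.* (a ℤ.+ - b) ≡ c ℤ.* a ℤ.+ - (c ℤ.* b)
  distrib = ℤ-Solver.solve-∀

δ : ℕ → ℕ → ℕ
δ s k = if does (s ≟ k) then 1 else 0

-- Binomial theorem for x = (x - 1) + 1:  x^s = Σ_{j ≤ s} binom(s, j) (x - 1)^j.
binomial-expansion : ∀ s k → expansion (suc s) s k ≡ + δ s k
binomial-expansion zero    k = trans (ℤₚ.+-identityˡ _) (trans (ℤₚ.*-identityˡ (powCoeff 0 k)) (constant k))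
  where
  constant : ∀ k → powCoeff 0 k ≡ + δ 0 k
  constant zero    = refl
  constant (suc k) = refl
binomial-expansion (suc s) k = begin
  expansion (suc (suc s)) (suc s) k
    ≡⟨ expansion-pascal s k ⟩
  Σ< (suc s) (λ j → + binom s j ℤ.* powCoeff (suc j) k) ℤ.+ E
    ≡⟨ cong (ℤ._+ E) (expansion-shift s k) ⟩
  X k ℤ.+ - E ℤ.+ E
    ≡⟨ cancel (X k) E ⟩
  X k
    ≡⟨ shifted k ⟩
  + δ (suc s) k ∎
  where
  open ≡-Reasoning
  E = expansion (suc s) s k
  X : ℕ → ℤ
  X k = Σ< (suc s) (λ j → + binom s j ℤ.* coeffX k (xMinus1 ^^ j))
  cancel : ∀ a b → a ℤ.+ - b ℤ.+ b ≡ a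
  cancel = ℤ-Solver.solve-∀
  shifted : ∀ k → X k ≡ + δ (suc s) k
  shifted zero    = trans (Σ<-cong (suc s) (λ j → ℤₚ.*-zeroʳ (+ binom s j))) (Σ<-zero (suc s))
  shifted (suc k) = binomial-expansion s k

binomial-expansion-from : ∀ N s k → s < N → expansion N s k ≡ + δ s k
binomial-expansion-from (suc N) s k s<1+N with m≤n⇒m<n∨m≡n (≤-pred s<1+N)
... | inj₂ refl = binomial-expansion s k
... | inj₁ s<N  = trans (expansion-extend N s k s<N) (binomial-expansion-from N s k s<N)

filter-count : ∀ {A : Set} (g : A → ℕ) k x xs →
  δ (g x) k + length (filter (λ y → g y ≟ k) xs) ≡ length (filter (λ y → g y ≟ k) (x ∷ xs))
filter-count g k x xs with does (g x ≟ k)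
... | true  = refl
... | false = refl

-- Inverting binomial moments: if every g x (x ∈ xs) is below N, then
-- Σ_{j<N} (Σ_x binom(g x, j)) (x - 1)^j = Σ_x x^(g x) has x^k-coefficient #{x ∈ xs | g x = k}.
moment-inversion : ∀ {A : Set} (xs : List A) (g : A → ℕ) N k → (∀ x → x ∈ xs → g x < N) →
  Σ< N (λ j → + sumOver xs (λ x → binom (g x) j) ℤ.* powCoeff j k) ≡ + length (filter (λ x → g x ≟ k) xs)
moment-inversion []       g N k _     = trans (Σ<-cong N (λ j → ℤₚ.*-zeroˡ (powCoeff j k))) (Σ<-zero N)
moment-inversion (x ∷ xs) g N k bound = begin
  Σ< N (λ j → + (binom (g x) j + S j) ℤ.* powCoeff j k)
    ≡⟨ Σ<-cong N (λ j → pos-+-* (binom (g x) j) (S j) (powCoeff j k)) ⟩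
  Σ< N (λ j → + binom (g x) j ℤ.* powCoeff j k ℤ.+ + S j ℤ.* powCoeff j k)
    ≡⟨ Σ<-+ N _ _ ⟩
  expansion N (g x) k ℤ.+ Σ< N (λ j → + S j ℤ.* powCoeff j k)
    ≡⟨ cong₂ ℤ._+_ (binomial-expansion-from N (g x) k (bound x (here refl)))
                   (moment-inversion xs g N k (λ y y∈ → bound y (there y∈))) ⟩
  + δ (g x) k ℤ.+ + length (filter (λ y → g y ≟ k) xs)
    ≡⟨ ℤₚ.pos-+ (δ (g x) k) _ ⟨
  + (δ (g x) k + length (filter (λ y → g y ≟ k) xs))
    ≡⟨ cong +_ (filter-count g k x xs) ⟩
  + length (filter (λ y → g y ≟ k) (x ∷ xs)) ∎
  where
  open ≡-Reasoning
  S : ℕ → ℕ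
  S j = sumOver xs (λ y → binom (g y) j)

treesWith : ℕ → ℕ → List PlaneTree
treesWith n k = filter (λ t → special0 t ≟ k) (trees n)

treesWith-unique : ∀ n k → Unique (treesWith n k)
treesWith-unique n k = Unique.filter⁺ (λ t → special0 t ≟ k) (trees-unique n)

treesWith-spec : ∀ n k t → t ∈ treesWith n k ⇔ (size t ≡ suc n × special0 t ≡ k)
treesWith-spec n k t = mk⇔
  (λ t∈ → let t∈trees , sp = ∈-filter⁻ (λ t → special0 t ≟ k) t∈ in trees-sound n t t∈trees , sp)
  (λ (sz , sp) → ∈-filter⁺ (λ t → special0 t ≟ k) (trees-complete n t sz) sp)

-- The root is never special, so a tree with n + 1 vertices has at most n special vertices.
special0<size : ∀ n t → t ∈ trees n → special0 t < suc n
special0<size n t = ∈-map-elim (λ t → special0 t < suc n)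
  (λ cs cs∈ → s≤s (forestsFrom-below n zero cs cs∈))

coeff-fd : ∀ n k → coeff k (fd (suc n)) ≡ + length (treesWith n k)
coeff-fd n k = begin
  coeff k (fd (suc n))
    ≡⟨ coeff-polySum k (suc n) _ ⟩
  Σ< (suc n) (λ j → coeff k (const (+ (catalan (n ∸ j) * ((n ∸ j) C j))) ⊗ (xMinus1 ^^ j)))
    ≡⟨ Σ<-cong (suc n) (λ j → trans (coeff-const⊗ k _ (xMinus1 ^^ j))
                                     (cong (λ m → + m ℤ.* powCoeff j k) (sym (moment-trees n j)))) ⟩
  Σ< (suc n) (λ j → + sumOver (trees n) (λ t → binom (special0 t) j) ℤ.* powCoeff j k)
    ≡⟨ moment-inversion (trees n) special0 (suc n) k (special0<size n) ⟩
  + length (treesWith n k) ∎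
  where open ≡-Reasoning

corollary3p5 : (d : ℕ) → d ≥ 1 → (k : ℕ) →
    Σ (List PlaneTree) λ L →
      Unique L
      × ((t : PlaneTree) → (t ∈ L) ⇔ ((size t ≡ d) × (special0 t ≡ k)))
      × (coeff k (fd d) ≡ + (length L))
corollary3p5 zero    ()  k
corollary3p5 (suc n) _   k = treesWith n k , treesWith-unique n k , treesWith-spec n k , coeff-fd n k
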